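{- For $n\ge 0$ let $C_n(u,\alpha)=\sum_{i=0}^n\binom ni (\alpha)_i\,u^{n-i}$. Then, as formal power series in $x$, \[\sum_{m\ge0} C_{2m}(u,\alpha)\frac{x^m}{m!}=e^{u^2x}\sum_{k\ge0}\frac{(\alpha)_{2k}}{(1-2ux)^{2k+\alpha}}\frac{x^k}{k!}.\]
   Context: $(\alpha)_n=\alpha(\alpha+1)\cdots(\alpha+n-1)$ is the rising factorial with $(\alpha)_0=1$; $u$ and $\alpha$ are indeterminates (or complex parameters), and $(1-2ux)^{ -\beta}$ denotes the formal binomial series. -}

module Defs where

open import Level using (Level)
open import Data.Nat as ℕ using (ℕ; zero; suc; _∸_; _≤?_)
open import Data.Nat.Combinatorics using (_C_)
open import Relation.Nullary using (yes; no)
open import Algebra.Bundles using (CommutativeRing)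

-- Everything is developed over an arbitrary commutative ring R in which
-- the factorials are invertible (e.g. ℚ[u,α], ℂ); inv n is meant to be 1/n!.
module Series {c ℓ : Level} (R : CommutativeRing c ℓ) (inv : ℕ → CommutativeRing.Carrier R) where
  open CommutativeRing R

  fromℕ : ℕ → Carrier
  fromℕ zero    = 0#
  fromℕ (suc n) = 1# + fromℕ n

  pow : Carrier → ℕ → Carrier
  pow x zero    = 1#
  pow x (suc n) = x * pow x n

  Σ≤ : ℕ → (ℕ → Carrier) → Carrier
  Σ≤ zero    f = f 0
  Σ≤ (suc n) f = Σ≤ n f + f (suc n)

  poch : Carrier → ℕ → Carrier
  poch α zero    = 1#
  poch α (suc n) = poch α n * (α + fromℕ n)

  Cpoly : ℕ → Carrier → Carrier → Carrier
  Cpoly n u α = Σ≤ n (λ i → fromℕ (n C i) * poch α i * pow u (n ∸ i))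

  FPS : Set c
  FPS = ℕ → Carrier

  _≈ₛ_ : FPS → FPS → Set ℓ
  f ≈ₛ g = ∀ n → f n ≈ g n

  _⊛_ : FPS → FPS → FPS
  (f ⊛ g) n = Σ≤ n (λ i → f i * g (n ∸ i))

  _·ₛ_ : Carrier → FPS → FPS
  (a ·ₛ f) n = a * f n

  xpow* : ℕ → FPS → FPS
  xpow* k f n with k ≤? n
  ... | yes _ = f (n ∸ k)
  ... | no  _ = 0#

  expS : Carrier → FPS
  expS a n = pow a n * inv n

  -- formal binomial series (1 - a x)^{-β} = Σ_j (β)_j a^j x^j / j!
  binomS : Carrier → Carrier → FPS
  binomS a β j = poch β j * pow a j * inv j

  -- Σ_{k≥0} t k, for a family with t k ∈ x^k R[[x]]
  -- (only t 0, …, t n can contribute to the coefficient of x^n)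
  Σ∞ : (ℕ → FPS) → FPS
  Σ∞ t n = Σ≤ n (λ k → t k n)

  LHS : Carrier → Carrier → FPS
  LHS u α m = Cpoly (2 ℕ.* m) u α * inv m

  RHS : Carrier → Carrier → FPS
  RHS u α = expS (u * u) ⊛
    Σ∞ (λ k → (poch α (2 ℕ.* k) * inv k) ·ₛ
               xpow* k (binomS (fromℕ 2 * u) (fromℕ (2 ℕ.* k) + α)))

{-# OPTIONS --safe #-}
-- Put aᵢ = (α)ᵢ and read aᵢ umbrally as aⁱ, so that C_n(u,α) = (a + u)ⁿ. Then
-- C_{2m} = ((a + u)²)ᵐ = (u² + (a² + 2u a))ᵐ, expanded binomially in u², with
-- (a² + 2u a)ⁿ = Σₖ (n choose k) a^{n+k} (2u)^{n-k}; both sides satisfy the same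
-- Pascal-type recurrence in m. Exponential generating functions turn binomial
-- convolutions into Cauchy products: the powers of u² give e^{u²x}, and
-- (α)_{n+k} = (α)_{2k} (2k+α)_{n-k} turns the inner sums into the binomial series
-- (α)_{2k} xᵏ/k! (1 - 2ux)^{-(2k+α)}.
module Submission where

open import Defs
open import Data.Nat using (ℕ; _!)
open import Algebra.Bundles using (CommutativeRing)

open import Level using (Level)
open import Function using (_∘_)
import Data.Nat as ℕ
open import Data.Nat using (zero; suc; _∸_; _≤_; _≤?_)
import Data.Nat.Properties as ℕ
open import Data.Nat.Combinatorics
  using (_C_; nCk+nC[k+1]≡[n+1]C[k+1]; k>n⇒nCk≡0; nCk≡n!/k![n-k]!; k![n∸k]!∣n!)
open import Data.Nat.DivMod using (m/n*n≡m)
open import Relation.Nullary using (yes; no)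
open import Relation.Nullary.Negation using (contradiction)
open import Relation.Binary.PropositionalEquality as ≡ using (_≡_)
import Algebra.Properties.Semiring.Mult as SemiringMult

nCk*k![n∸k]!≡n! : ∀ {n k} → k ≤ n → (n C k) ℕ.* (k ! ℕ.* (n ∸ k) !) ≡ n !
nCk*k![n∸k]!≡n! {n} {k} k≤n = ≡.trans
  (≡.cong (ℕ._* (k ! ℕ.* (n ∸ k) !)) (nCk≡n!/k![n-k]! k≤n))
  (m/n*n≡m {{ℕ._!*_!≢0 k (n ∸ k)}} (k![n∸k]!∣n! k≤n))

2*k+[n∸k]≡n+k : ∀ {n k} → k ≤ n → 2 ℕ.* k ℕ.+ (n ∸ k) ≡ n ℕ.+ k
2*k+[n∸k]≡n+k {n} {k} k≤n = begin
  (k ℕ.+ (k ℕ.+ 0)) ℕ.+ (n ∸ k) ≡⟨ ≡.cong (λ j → (k ℕ.+ j) ℕ.+ (n ∸ k)) (ℕ.+-identityʳ k) ⟩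
  (k ℕ.+ k) ℕ.+ (n ∸ k)         ≡⟨ ℕ.+-assoc k k (n ∸ k) ⟩
  k ℕ.+ (k ℕ.+ (n ∸ k))         ≡⟨ ≡.cong (k ℕ.+_) (ℕ.m+[n∸m]≡n k≤n) ⟩
  k ℕ.+ n                       ≡⟨ ℕ.+-comm k n ⟩
  n ℕ.+ k                       ∎
  where open ≡.≡-Reasoning

module SeriesLemmas {c ℓ : Level} (R : CommutativeRing c ℓ) (inv : ℕ → CommutativeRing.Carrier R) where
  open CommutativeRing R
  open Series R inv
  open SemiringMult semiring using (_×_; ×-homo-+; ×1-homo-*)
  open import Relation.Binary.Reasoning.Setoid setoid
  open import Algebra.Solver.Ring.NaturalCoefficients.Default commutativeSemiring

  fromℕ≈×1# : ∀ n → fromℕ n ≈ n × 1#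
  fromℕ≈×1# zero    = refl
  fromℕ≈×1# (suc n) = +-congˡ (fromℕ≈×1# n)

  fromℕ-homo-+ : ∀ m n → fromℕ (m ℕ.+ n) ≈ fromℕ m + fromℕ n
  fromℕ-homo-+ m n = begin
    fromℕ (m ℕ.+ n)   ≈⟨ fromℕ≈×1# (m ℕ.+ n) ⟩
    (m ℕ.+ n) × 1#    ≈⟨ ×-homo-+ 1# m n ⟩
    m × 1# + n × 1#   ≈⟨ +-cong (fromℕ≈×1# m) (fromℕ≈×1# n) ⟨
    fromℕ m + fromℕ n ∎

  fromℕ-homo-* : ∀ m n → fromℕ (m ℕ.* n) ≈ fromℕ m * fromℕ n
  fromℕ-homo-* m n = begin
    fromℕ (m ℕ.* n)     ≈⟨ fromℕ≈×1# (m ℕ.* n) ⟩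
    (m ℕ.* n) × 1#      ≈⟨ ×1-homo-* m n ⟩
    (m × 1#) * (n × 1#) ≈⟨ *-cong (fromℕ≈×1# m) (fromℕ≈×1# n) ⟨
    fromℕ m * fromℕ n   ∎

  Σ≤-cong : ∀ n {f g : ℕ → Carrier} → (∀ i → i ≤ n → f i ≈ g i) → Σ≤ n f ≈ Σ≤ n g
  Σ≤-cong zero    f≈g = f≈g 0 ℕ.z≤n
  Σ≤-cong (suc n) f≈g = +-cong (Σ≤-cong n (λ i i≤n → f≈g i (ℕ.m≤n⇒m≤1+n i≤n))) (f≈g (suc n) ℕ.≤-refl)

  Σ≤-distrib-+ : ∀ n f g → Σ≤ n (λ i → f i + g i) ≈ Σ≤ n f + Σ≤ n g
  Σ≤-distrib-+ zero    f g = refl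
  Σ≤-distrib-+ (suc n) f g = trans (+-congʳ (Σ≤-distrib-+ n f g))
    (solve 4 (λ a b x y → (a :+ b) :+ (x :+ y) := (a :+ x) :+ (b :+ y)) refl _ _ _ _)

  *-distribˡ-Σ≤ : ∀ n r f → r * Σ≤ n f ≈ Σ≤ n (λ i → r * f i)
  *-distribˡ-Σ≤ zero    r f = refl
  *-distribˡ-Σ≤ (suc n) r f = trans (distribˡ _ _ _) (+-congʳ (*-distribˡ-Σ≤ n r f))

  Σ≤-suc : ∀ n f → Σ≤ (suc n) f ≈ f 0 + Σ≤ n (f ∘ suc)
  Σ≤-suc zero    f = refl
  Σ≤-suc (suc n) f = trans (+-congʳ (Σ≤-suc n f)) (+-assoc _ _ _)

  Σ≤-reverse : ∀ n f → Σ≤ n f ≈ Σ≤ n (λ i → f (n ∸ i))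
  Σ≤-reverse zero    f = refl
  Σ≤-reverse (suc n) f = begin
    Σ≤ (suc n) f                         ≈⟨ Σ≤-suc n f ⟩
    f 0 + Σ≤ n (f ∘ suc)                 ≈⟨ +-congˡ (Σ≤-reverse n (f ∘ suc)) ⟩
    f 0 + Σ≤ n (λ i → f (suc (n ∸ i)))   ≈⟨ +-congˡ (Σ≤-cong n λ i i≤n →
                                              reflexive (≡.cong f (ℕ.+-∸-assoc 1 i≤n))) ⟨
    f 0 + Σ≤ n (λ i → f (suc n ∸ i))     ≈⟨ +-comm _ _ ⟩
    Σ≤ n (λ i → f (suc n ∸ i)) + f 0     ≈⟨ +-congˡ (reflexive (≡.cong f (ℕ.n∸n≡0 n))) ⟨
    Σ≤ (suc n) (λ i → f (suc n ∸ i))     ∎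

  ⊛-comm : ∀ f g → (f ⊛ g) ≈ₛ (g ⊛ f)
  ⊛-comm f g n = trans (Σ≤-reverse n _) (Σ≤-cong n λ i i≤n →
    trans (*-comm _ _) (*-congʳ (reflexive (≡.cong g (ℕ.m∸[m∸n]≡n i≤n)))))

  ⊛-congʳ : ∀ {f f'} g → f ≈ₛ f' → (f ⊛ g) ≈ₛ (f' ⊛ g)
  ⊛-congʳ g f≈f' n = Σ≤-cong n (λ i _ → *-congʳ (f≈f' i))

  poch-+ : ∀ α j l → poch α j * poch (fromℕ j + α) l ≈ poch α (j ℕ.+ l)
  poch-+ α j zero    = trans (*-identityʳ _) (reflexive (≡.cong (poch α) (≡.sym (ℕ.+-identityʳ j))))
  poch-+ α j (suc l) = begin
    poch α j * (poch (fromℕ j + α) l * (fromℕ j + α + fromℕ l))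
      ≈⟨ *-assoc _ _ _ ⟨
    poch α j * poch (fromℕ j + α) l * (fromℕ j + α + fromℕ l)
      ≈⟨ *-cong (poch-+ α j l) (solve 3 (λ x y z → x :+ y :+ z := y :+ (x :+ z)) refl _ _ _) ⟩
    poch α (j ℕ.+ l) * (α + (fromℕ j + fromℕ l))
      ≈⟨ *-congˡ (+-congˡ (fromℕ-homo-+ j l)) ⟨
    poch α (j ℕ.+ l) * (α + fromℕ (j ℕ.+ l))
      ≈⟨ reflexive (≡.cong (poch α) (ℕ.+-suc j l)) ⟨
    poch α (j ℕ.+ suc l) ∎

  binomialConv : (ℕ → Carrier) → (ℕ → Carrier) → ℕ → Carrier
  binomialConv f g n = Σ≤ n (λ k → fromℕ (n C k) * f k * g (n ∸ k))

  binomialConv-zero : ∀ f g → binomialConv f g 0 ≈ f 0 * g 0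
  binomialConv-zero f g = *-congʳ (trans (*-congʳ (+-identityʳ 1#)) (*-identityˡ _))

  binomialConv-congˡ : ∀ n {f f'} g → (∀ k → f k ≈ f' k) → binomialConv f g n ≈ binomialConv f' g n
  binomialConv-congˡ n g f≈f' = Σ≤-cong n (λ k _ → *-congʳ (*-congˡ (f≈f' k)))

  binomialConv-distribˡ-+ : ∀ n f f' g →
    binomialConv (λ k → f k + f' k) g n ≈ binomialConv f g n + binomialConv f' g n
  binomialConv-distribˡ-+ n f f' g = trans
    (Σ≤-cong n (λ k _ → solve 4 (λ c x y z → c :* (x :+ y) :* z := c :* x :* z :+ c :* y :* z) refl _ _ _ _))
    (Σ≤-distrib-+ n _ _)

  binomialConv-*ˡ : ∀ n r f g → binomialConv (λ k → r * f k) g n ≈ r * binomialConv f g n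
  binomialConv-*ˡ n r f g = trans
    (Σ≤-cong n (λ k _ → solve 4 (λ c r x z → c :* (r :* x) :* z := r :* (c :* x :* z)) refl _ _ _ _))
    (sym (*-distribˡ-Σ≤ n r _))

  binomialConv-*ʳ : ∀ n r f g → binomialConv f (λ j → r * g j) n ≈ r * binomialConv f g n
  binomialConv-*ʳ n r f g = trans
    (Σ≤-cong n (λ k _ → solve 4 (λ c r x z → c :* x :* (r :* z) := r :* (c :* x :* z)) refl _ _ _ _))
    (sym (*-distribˡ-Σ≤ n r _))

  binomialConv-suc : ∀ n f g →
    binomialConv f g (suc n) ≈ binomialConv (f ∘ suc) g n + binomialConv f (g ∘ suc) n
  binomialConv-suc n f g = begin
    binomialConv f g (suc n)                                ≈⟨ Σ≤-suc n F ⟩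
    F 0 + Σ≤ n (F ∘ suc)                                    ≈⟨ +-congˡ (Σ≤-cong n (λ k _ → pascal k)) ⟩
    F 0 + Σ≤ n (λ k → A k + G k)                            ≈⟨ +-congˡ (Σ≤-distrib-+ n A G) ⟩
    F 0 + (binomialConv (f ∘ suc) g n + Σ≤ n G)             ≈⟨ solve 3 (λ x y z → x :+ (y :+ z) := y :+ (x :+ z)) refl _ _ _ ⟩
    binomialConv (f ∘ suc) g n + (F 0 + Σ≤ n G)             ≈⟨ +-congˡ unshifted ⟩
    binomialConv (f ∘ suc) g n + binomialConv f (g ∘ suc) n ∎
    where
    F A G H : ℕ → Carrier
    F k = fromℕ (suc n C k) * f k * g (suc n ∸ k)
    A k = fromℕ (n C k) * f (suc k) * g (n ∸ k)
    G k = fromℕ (n C suc k) * f (suc k) * g (n ∸ k)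
    H k = fromℕ (n C k) * f k * g (suc n ∸ k)

    pascal : ∀ k → F (suc k) ≈ A k + G k
    pascal k = begin
      fromℕ (suc n C suc k) * f (suc k) * g (n ∸ k)
        ≈⟨ *-congʳ (*-congʳ (reflexive (≡.cong fromℕ (nCk+nC[k+1]≡[n+1]C[k+1] n k)))) ⟨
      fromℕ (n C k ℕ.+ n C suc k) * f (suc k) * g (n ∸ k)
        ≈⟨ *-congʳ (*-congʳ (fromℕ-homo-+ (n C k) _)) ⟩
      (fromℕ (n C k) + fromℕ (n C suc k)) * f (suc k) * g (n ∸ k)
        ≈⟨ solve 4 (λ c d x z → (c :+ d) :* x :* z := c :* x :* z :+ d :* x :* z) refl _ _ _ _ ⟩
      A k + G k ∎

    unshifted : F 0 + Σ≤ n G ≈ binomialConv f (g ∘ suc) n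
    unshifted = begin
      F 0 + Σ≤ n G        ≈⟨ Σ≤-suc n H ⟨
      Σ≤ n H + H (suc n)  ≈⟨ +-congˡ H-top ⟩
      Σ≤ n H + 0#         ≈⟨ +-identityʳ _ ⟩
      Σ≤ n H              ≈⟨ Σ≤-cong n (λ k k≤n → *-congˡ (reflexive (≡.cong g (ℕ.+-∸-assoc 1 k≤n)))) ⟩
      binomialConv f (g ∘ suc) n ∎
      where
      H-top : H (suc n) ≈ 0#
      H-top = begin
        fromℕ (n C suc n) * f (suc n) * g (n ∸ n) ≈⟨ *-congʳ (*-congʳ (reflexive (≡.cong fromℕ (k>n⇒nCk≡0 (ℕ.n<1+n n))))) ⟩
        0# * f (suc n) * g (n ∸ n)                ≈⟨ trans (*-congʳ (zeroˡ _)) (zeroˡ _) ⟩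
        0#                                        ∎

  binomialConv-pow-suc : ∀ n f v →
    binomialConv f (pow v) (suc n) ≈ binomialConv (f ∘ suc) (pow v) n + v * binomialConv f (pow v) n
  binomialConv-pow-suc n f v = trans (binomialConv-suc n f (pow v)) (+-congˡ (binomialConv-*ʳ n v f (pow v)))

  -- Reading aᵢ umbrally as aⁱ, quadPow a t n is (a² + t a)ⁿ.
  quadPow : (ℕ → Carrier) → Carrier → ℕ → Carrier
  quadPow a t n = binomialConv (λ k → a (n ℕ.+ k)) (pow t) n

  quadPow-suc : ∀ a t n → quadPow a t (suc n) ≈ quadPow (a ∘ suc ∘ suc) t n + t * quadPow (a ∘ suc) t n
  quadPow-suc a t n = trans (binomialConv-pow-suc n _ t)
    (+-congʳ (binomialConv-congˡ n (pow t) (λ k → reflexive (≡.cong (a ∘ suc) (ℕ.+-suc n k)))))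

  binomialConv-quadPow-suc : ∀ a t s m →
    binomialConv (quadPow a t) (pow s) (suc m) ≈
      binomialConv (quadPow (a ∘ suc ∘ suc) t) (pow s) m + t * binomialConv (quadPow (a ∘ suc) t) (pow s) m
        + s * binomialConv (quadPow a t) (pow s) m
  binomialConv-quadPow-suc a t s m = begin
    binomialConv (quadPow a t) (pow s) (suc m)
      ≈⟨ binomialConv-pow-suc m _ s ⟩
    binomialConv (quadPow a t ∘ suc) (pow s) m + s * binomialConv (quadPow a t) (pow s) m
      ≈⟨ +-congʳ (binomialConv-congˡ m (pow s) (quadPow-suc a t)) ⟩
    binomialConv (λ n → quadPow (a ∘ suc ∘ suc) t n + t * quadPow (a ∘ suc) t n) (pow s) m
      + s * binomialConv (quadPow a t) (pow s) m
      ≈⟨ +-congʳ (binomialConv-distribˡ-+ m _ _ (pow s)) ⟩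
    binomialConv (quadPow (a ∘ suc ∘ suc) t) (pow s) m + binomialConv (λ n → t * quadPow (a ∘ suc) t n) (pow s) m
      + s * binomialConv (quadPow a t) (pow s) m
      ≈⟨ +-congʳ (+-congˡ (binomialConv-*ˡ m t _ (pow s))) ⟩
    binomialConv (quadPow (a ∘ suc ∘ suc) t) (pow s) m + t * binomialConv (quadPow (a ∘ suc) t) (pow s) m
      + s * binomialConv (quadPow a t) (pow s) m ∎

  binomialConv-pow-even : ∀ u m a →
    binomialConv a (pow u) (2 ℕ.* m) ≈ binomialConv (quadPow a (fromℕ 2 * u)) (pow (u * u)) m
  binomialConv-pow-even u zero a = begin
    binomialConv a (pow u) 0 ≈⟨ binomialConv-zero a (pow u) ⟩
    a 0 * 1#                 ≈⟨ *-identityʳ _ ⟨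
    a 0 * 1# * 1#            ≈⟨ *-congʳ (binomialConv-zero a (pow t)) ⟨
    quadPow a t 0 * 1#       ≈⟨ binomialConv-zero (quadPow a t) (pow s) ⟨
    binomialConv (quadPow a t) (pow s) 0 ∎
    where
    t s : Carrier
    t = fromℕ 2 * u
    s = u * u
  binomialConv-pow-even u (suc m) a = begin
    P a (2 ℕ.* suc m)                                     ≈⟨ reflexive (≡.cong (P a) (ℕ.*-suc 2 m)) ⟩
    P a (suc (suc (2 ℕ.* m)))                             ≈⟨ binomialConv-pow-suc (suc (2 ℕ.* m)) a u ⟩
    P a′ (suc (2 ℕ.* m)) + u * P a (suc (2 ℕ.* m))        ≈⟨ +-cong (binomialConv-pow-suc (2 ℕ.* m) a′ u)
                                                                    (*-congˡ (binomialConv-pow-suc (2 ℕ.* m) a u)) ⟩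
    (P a″ (2 ℕ.* m) + u * P a′ (2 ℕ.* m)) + u * (P a′ (2 ℕ.* m) + u * P a (2 ℕ.* m))
      ≈⟨ +-cong (+-cong (IH a″) (*-congˡ (IH a′))) (*-congˡ (+-cong (IH a′) (*-congˡ (IH a)))) ⟩
    (Q a″ m + u * Q a′ m) + u * (Q a′ m + u * Q a m)
      ≈⟨ solve 4 (λ x y z w → (x :+ w :* y) :+ w :* (y :+ w :* z) := x :+ (w :+ w) :* y :+ (w :* w) :* z) refl _ _ _ _ ⟩
    Q a″ m + (u + u) * Q a′ m + s * Q a m                 ≈⟨ +-congʳ (+-congˡ (*-congʳ u+u≈2u)) ⟩
    Q a″ m + t * Q a′ m + s * Q a m                       ≈⟨ binomialConv-quadPow-suc a t s m ⟨
    Q a (suc m)                                           ∎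
    where
    t s : Carrier
    t = fromℕ 2 * u
    s = u * u
    a′ a″ : ℕ → Carrier
    a′ = a ∘ suc
    a″ = a ∘ suc ∘ suc
    P Q : (ℕ → Carrier) → ℕ → Carrier
    P b n = binomialConv b (pow u) n
    Q b n = binomialConv (quadPow b t) (pow s) n
    IH : ∀ b → P b (2 ℕ.* m) ≈ Q b m
    IH = binomialConv-pow-even u m
    u+u≈2u : u + u ≈ t
    u+u≈2u = solve 1 (λ x → x :+ x := (con 1 :+ (con 1 :+ con 0)) :* x) refl u

  xpow*-≤ : ∀ k f n → k ≤ n → xpow* k f n ≈ f (n ∸ k)
  xpow*-≤ k f n k≤n with k ≤? n
  ... | yes _   = refl
  ... | no  k≰n = contradiction k≤n k≰n

  egf : (ℕ → Carrier) → FPS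
  egf f n = f n * inv n

  rhsTerm : Carrier → Carrier → ℕ → FPS
  rhsTerm α t k = (poch α (2 ℕ.* k) * inv k) ·ₛ xpow* k (binomS t (fromℕ (2 ℕ.* k) + α))

  module _ (inv-! : ∀ n → inv n * fromℕ (n !) ≈ 1#) where

    inv[n]*nCk≈inv[k]*inv[n∸k] : ∀ {n k} → k ≤ n → inv n * fromℕ (n C k) ≈ inv k * inv (n ∸ k)
    inv[n]*nCk≈inv[k]*inv[n∸k] {n} {k} k≤n = begin
      inv n * fromℕ (n C k)                                     ≈⟨ *-identityʳ _ ⟨
      inv n * fromℕ (n C k) * 1#
        ≈⟨ *-congˡ (trans (*-cong (inv-! k) (inv-! (n ∸ k))) (*-identityʳ 1#)) ⟨
      inv n * fromℕ (n C k) * ((inv k * k!) * (inv (n ∸ k) * r!))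
        ≈⟨ solve 6 (λ i c j x l y → i :* c :* ((j :* x) :* (l :* y)) := (i :* (c :* (x :* y))) :* (j :* l)) refl _ _ _ _ _ _ ⟩
      inv n * (fromℕ (n C k) * (k! * r!)) * (inv k * inv (n ∸ k)) ≈⟨ *-congʳ (*-congˡ n!≈) ⟩
      inv n * fromℕ (n !) * (inv k * inv (n ∸ k))               ≈⟨ trans (*-congʳ (inv-! n)) (*-identityˡ _) ⟩
      inv k * inv (n ∸ k)                                       ∎
      where
      k! r! : Carrier
      k! = fromℕ (k !)
      r! = fromℕ ((n ∸ k) !)
      n!≈ : fromℕ (n C k) * (k! * r!) ≈ fromℕ (n !)
      n!≈ = begin
        fromℕ (n C k) * (k! * r!)                     ≈⟨ *-congˡ (fromℕ-homo-* (k !) ((n ∸ k) !)) ⟨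
        fromℕ (n C k) * fromℕ (k ! ℕ.* (n ∸ k) !)     ≈⟨ fromℕ-homo-* (n C k) _ ⟨
        fromℕ ((n C k) ℕ.* (k ! ℕ.* (n ∸ k) !))       ≈⟨ reflexive (≡.cong fromℕ (nCk*k![n∸k]!≡n! k≤n)) ⟩
        fromℕ (n !)                                   ∎

    egf-binomialConv : ∀ f g → egf (binomialConv f g) ≈ₛ (egf f ⊛ egf g)
    egf-binomialConv f g n = begin
      binomialConv f g n * inv n                                   ≈⟨ *-comm _ _ ⟩
      inv n * binomialConv f g n                                   ≈⟨ *-distribˡ-Σ≤ n (inv n) _ ⟩
      Σ≤ n (λ k → inv n * (fromℕ (n C k) * f k * g (n ∸ k)))      ≈⟨ Σ≤-cong n term ⟩
      (egf f ⊛ egf g) n                                            ∎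
      where
      term : ∀ k → k ≤ n → inv n * (fromℕ (n C k) * f k * g (n ∸ k)) ≈ egf f k * egf g (n ∸ k)
      term k k≤n = begin
        inv n * (fromℕ (n C k) * f k * g (n ∸ k))
          ≈⟨ solve 4 (λ i c x y → i :* (c :* x :* y) := (i :* c) :* (x :* y)) refl _ _ _ _ ⟩
        (inv n * fromℕ (n C k)) * (f k * g (n ∸ k))
          ≈⟨ *-congʳ (inv[n]*nCk≈inv[k]*inv[n∸k] k≤n) ⟩
        (inv k * inv (n ∸ k)) * (f k * g (n ∸ k))
          ≈⟨ solve 4 (λ i j x y → (i :* j) :* (x :* y) := (x :* i) :* (y :* j)) refl _ _ _ _ ⟩
        egf f k * egf g (n ∸ k) ∎

    egf-quadPow-poch : ∀ α t → egf (quadPow (poch α) t) ≈ₛ Σ∞ (rhsTerm α t)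
    egf-quadPow-poch α t n = trans (egf-binomialConv (λ k → poch α (n ℕ.+ k)) (pow t) n) (Σ≤-cong n term)
      where
      term : ∀ k → k ≤ n → egf (λ k → poch α (n ℕ.+ k)) k * egf (pow t) (n ∸ k) ≈ rhsTerm α t k n
      term k k≤n = begin
        poch α (n ℕ.+ k) * inv k * (pow t (n ∸ k) * inv (n ∸ k))
          ≈⟨ *-congʳ (*-congʳ (reflexive (≡.cong (poch α) (2*k+[n∸k]≡n+k k≤n)))) ⟨
        poch α (2 ℕ.* k ℕ.+ (n ∸ k)) * inv k * (pow t (n ∸ k) * inv (n ∸ k))
          ≈⟨ *-congʳ (*-congʳ (poch-+ α (2 ℕ.* k) (n ∸ k))) ⟨
        poch α (2 ℕ.* k) * poch β (n ∸ k) * inv k * (pow t (n ∸ k) * inv (n ∸ k))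
          ≈⟨ solve 5 (λ a b i p j → a :* b :* i :* (p :* j) := (a :* i) :* (b :* p :* j)) refl _ _ _ _ _ ⟩
        (poch α (2 ℕ.* k) * inv k) * binomS t β (n ∸ k)
          ≈⟨ *-congˡ (xpow*-≤ k (binomS t β) n k≤n) ⟨
        rhsTerm α t k n ∎
        where
        β : Carrier
        β = fromℕ (2 ℕ.* k) + α

theorem3p2 : ∀ {c ℓ} (R : CommutativeRing c ℓ) (inv : ℕ → CommutativeRing.Carrier R) →
    let open CommutativeRing R
        open Series R inv
    in (∀ n → inv n * fromℕ (n !) ≈ 1#) →
       ∀ (u α : Carrier) → LHS u α ≈ₛ RHS u α
theorem3p2 R inv inv-! u α m = begin
  LHS u α m                                         ≈⟨ *-congʳ (binomialConv-pow-even u m (poch α)) ⟩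
  egf (binomialConv (quadPow (poch α) t) (pow s)) m ≈⟨ egf-binomialConv inv-! (quadPow (poch α) t) (pow s) m ⟩
  (egf (quadPow (poch α) t) ⊛ expS s) m             ≈⟨ ⊛-congʳ (expS s) (egf-quadPow-poch inv-! α t) m ⟩
  (Σ∞ (rhsTerm α t) ⊛ expS s) m                     ≈⟨ ⊛-comm _ _ m ⟩
  RHS u α m                                         ∎
  where
  open CommutativeRing R
  open Series R inv
  open SeriesLemmas R inv
  open import Relation.Binary.Reasoning.Setoid setoid
  t s : Carrier
  t = fromℕ 2 * u
  s = u * u
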